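{- $$F_{\{312,321\}}(x,q,z)=\frac{1-qz}{1-(x+q)z+(x-1)qz^2}.$$
   Context: For permutations $\pi=\pi_1\cdots\pi_n\in\mathfrak{S}_n$ and $\sigma\in\mathfrak{S}_m$, $\pi$ contains $\sigma$ if there are indices $i_1<\dots<i_m$ such that $\pi_{i_1}\cdots\pi_{i_m}$ is in the same relative order as $\sigma$; otherwise $\pi$ avoids $\sigma$. For a set $\Sigma$ of patterns, $\mathfrak{S}_n(\Sigma)$ is the set of permutations in $\mathfrak{S}_n$ avoiding every pattern in $\Sigma$. $\mathrm{fp}(\pi)=|\{i:\pi_i=i\}|$, $\mathrm{exc}(\pi)=|\{i:\pi_i>i\}|$, and $F_\Sigma(x,q,z)=\sum_{n\ge0}\sum_{\pi\in\mathfrak{S}_n(\Sigma)}x^{\mathrm{fp}(\pi)}q^{\mathrm{exc}(\pi)}z^n$. -}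

module Defs where

open import Data.Nat using (ℕ; zero; suc; _+_; _<ᵇ_; _≡ᵇ_)
open import Data.Bool using (Bool; true; false; _∧_; if_then_else_)
open import Data.List using (List; []; _∷_; map; concatMap; foldr; length; filterᵇ)
open import Data.Bool.ListAction using (any)
open import Data.Integer as ℤ using (ℤ; +_)
open import Relation.Binary.PropositionalEquality using (_≡_)
open import Data.Product using (_×_; _,_; proj₁; proj₂)

-- A permutation of length n is represented in one-line notation as the list
-- π₁ ⋯ πₙ of the values 1..n.

insertions : ℕ → List ℕ → List (List ℕ)
insertions a []       = (a ∷ []) ∷ []
insertions a (b ∷ bs) = (a ∷ b ∷ bs) ∷ map (b ∷_) (insertions a bs)

perms : ℕ → List (List ℕ)
perms zero    = [] ∷ []
perms (suc n) = concatMap (insertions (suc n)) (perms n)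

subseqs : List ℕ → List (List ℕ)
subseqs []       = [] ∷ []
subseqs (a ∷ as) = map (a ∷_) (subseqs as) ++' subseqs as
  where
  _++'_ : List (List ℕ) → List (List ℕ) → List (List ℕ)
  [] ++' ys = ys
  (x ∷ xs) ++' ys = x ∷ (xs ++' ys)

countLess : ℕ → List ℕ → ℕ
countLess a []       = 0
countLess a (b ∷ bs) = (if b <ᵇ a then 1 else 0) + countLess a bs

std : List ℕ → List ℕ
std w = map (λ a → suc (countLess a w)) w

listEq : List ℕ → List ℕ → Bool
listEq []       []       = true
listEq (a ∷ as) (b ∷ bs) = (a ≡ᵇ b) ∧ listEq as bs
listEq _        _        = false

contains : List ℕ → List ℕ → Bool
contains π σ = any (λ s → listEq (std s) σ) (subseqs π)

avoidsAll : List ℕ → List (List ℕ) → Bool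
avoidsAll π Σ = foldr (λ σ b → (if contains π σ then false else true) ∧ b) true Σ

avoiders : List (List ℕ) → ℕ → List (List ℕ)
avoiders Σ n = filterᵇ (λ π → avoidsAll π Σ) (perms n)

-- fp and exc, with positions counted from 1
fpFrom : ℕ → List ℕ → ℕ
fpFrom i []       = 0
fpFrom i (a ∷ as) = (if a ≡ᵇ i then 1 else 0) + fpFrom (suc i) as

excFrom : ℕ → List ℕ → ℕ
excFrom i []       = 0
excFrom i (a ∷ as) = (if i <ᵇ a then 1 else 0) + excFrom (suc i) as

fp : List ℕ → ℕ
fp = fpFrom 1

exc : List ℕ → ℕ
exc = excFrom 1

-- Formal power series in x, q, z with integer coefficients:
-- S n i j = coefficient of x^i q^j z^n.
Series : Set
Series = ℕ → ℕ → ℕ → ℤ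

sumℤ : List ℤ → ℤ
sumℤ = foldr ℤ._+_ (+ 0)

splits : ℕ → List (ℕ × ℕ)
splits zero    = (0 , 0) ∷ []
splits (suc n) = (0 , suc n) ∷ map (λ p → (suc (proj₁ p) , proj₂ p)) (splits n)

_⊛_ : Series → Series → Series
(A ⊛ B) n i j =
  sumℤ (concatMap (λ a → concatMap (λ b → map (λ c →
      A (proj₁ a) (proj₁ b) (proj₁ c) ℤ.* B (proj₂ a) (proj₂ b) (proj₂ c))
    (splits j)) (splits i)) (splits n))

F : List (List ℕ) → Series
F Σ n i j = + length (filterᵇ (λ π → (fp π ≡ᵇ i) ∧ (exc π ≡ᵇ j)) (avoiders Σ n))

-- denominator 1 - (x+q)z + (x-1)qz² = 1 - xz - qz + xqz² - qz²
denom : Series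
denom 0 0 0 = + 1
denom 1 1 0 = ℤ.- (+ 1)
denom 1 0 1 = ℤ.- (+ 1)
denom 2 1 1 = + 1
denom 2 0 1 = ℤ.- (+ 1)
denom _ _ _ = + 0

numer : Series
numer 0 0 0 = + 1
numer 1 0 1 = ℤ.- (+ 1)
numer _ _ _ = + 0

{-# OPTIONS --safe #-}
module Submission where

-- A permutation avoids 312 and 321 exactly when each entry exceeds at most one entry to its
-- right.  Hence the permutations in 𝔖ₙ₊₁(312,321) arise, each once, from those in 𝔖ₙ(312,321)
-- by putting n+1 in one of the last two positions.  Appending n+1 adds a fixed point;
-- putting it before the last entry adds an excedance and removes the fixed point at n, if
-- there was one.  So if N counts the permutations whose last entry is not fixed, then
-- F = 1 + xzF + N and N = qzN + qz²F, and eliminating N yields the identity.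

open import Defs
open import Algebra.Bundles using (CommutativeMonoid)
open import Data.Bool using (Bool; true; false; _∧_; _∨_; not; if_then_else_; T)
open import Data.Bool.Properties using (∨-identityʳ; ∧-zeroʳ; ∧-distribˡ-∨; ∨-assoc; ∨-commutativeMonoid)
open import Algebra.Properties.CommutativeSemigroup (CommutativeMonoid.commutativeSemigroup ∨-commutativeMonoid)
  using () renaming (interchange to ∨-interchange)
open import Data.Bool.ListAction using (any; or)
open import Data.Empty using (⊥-elim)
import Data.List as List
open import Data.List using (List; []; _∷_; map; _++_; length; concat; concatMap; filterᵇ)
open import Data.List.Properties
  using (length-map; map-∘; map-cong; map-cong-local; filter-++; filter-reject; map-concatMap; concatMap-map)
open import Data.List.Relation.Unary.All as All using (All; []; _∷_)
open import Data.List.Relation.Unary.All.Properties using (map⁺; concat⁺; filter⁺)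
open import Data.List.Relation.Unary.AllPairs using ([]; _∷_)
open import Data.List.Relation.Unary.Unique.Propositional using (Unique)
open import Data.Nat using (ℕ; zero; suc; _<_; _≤_; _<ᵇ_; _≡ᵇ_; z≤n; s≤s)
open import Data.Nat.Properties using (_≟_; <⇒≤; <⇒≢; >⇒≢; ≤-pred; n<1+n; m<n⇒m<1+n)
open import Data.Product using (_×_; _,_; proj₁; proj₂)
open import Function using (_∘_)
open import Relation.Binary.PropositionalEquality
open import Relation.Nullary using (yes; no)
open import Relation.Nullary.Decidable using (T?)

private
  variable
    A B : Set

𝟙 : Bool → ℕ
𝟙 b = if b then 1 else 0

<ᵇ-irrefl : ∀ n → (n <ᵇ n) ≡ false
<ᵇ-irrefl zero    = refl
<ᵇ-irrefl (suc n) = <ᵇ-irrefl n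

<ᵇ-asym : ∀ m n → (m <ᵇ n) ≡ true → (n <ᵇ m) ≡ false
<ᵇ-asym zero    (suc n) _ = refl
<ᵇ-asym (suc m) (suc n) h = <ᵇ-asym m n h

<ᵇ-connex : ∀ m n → m ≢ n → (m <ᵇ n) ≡ false → (n <ᵇ m) ≡ true
<ᵇ-connex zero    zero    m≢n _ = ⊥-elim (m≢n refl)
<ᵇ-connex (suc m) zero    _   _ = refl
<ᵇ-connex (suc m) (suc n) m≢n h = <ᵇ-connex m n (m≢n ∘ cong suc) h

<⇒<ᵇ≡true : ∀ {m n} → m < n → (m <ᵇ n) ≡ true
<⇒<ᵇ≡true (s≤s z≤n)       = refl
<⇒<ᵇ≡true (s≤s (s≤s m<n)) = <⇒<ᵇ≡true (s≤s m<n)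

≥⇒<ᵇ≡false : ∀ {m n} → n ≤ m → (m <ᵇ n) ≡ false
≥⇒<ᵇ≡false z≤n       = refl
≥⇒<ᵇ≡false (s≤s n≤m) = ≥⇒<ᵇ≡false n≤m

≡ᵇ-refl : ∀ n → (n ≡ᵇ n) ≡ true
≡ᵇ-refl zero    = refl
≡ᵇ-refl (suc n) = ≡ᵇ-refl n

≢⇒≡ᵇ≡false : ∀ {m n} → m ≢ n → (m ≡ᵇ n) ≡ false
≢⇒≡ᵇ≡false {zero}  {zero}  m≢n = ⊥-elim (m≢n refl)
≢⇒≡ᵇ≡false {zero}  {suc n} _   = refl
≢⇒≡ᵇ≡false {suc m} {zero}  _   = refl
≢⇒≡ᵇ≡false {suc m} {suc n} m≢n = ≢⇒≡ᵇ≡false (m≢n ∘ cong suc)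

module PowerSeries where

  open import Data.Integer using (ℤ; +_; _+_; _-_; _*_; -_)
  open import Data.Integer.Properties
    using ( +-assoc; +-identityʳ; +-identityˡ; *-zeroʳ; *-identityʳ; *-distribˡ-+; neg-distrib-+
          ; +-commutativeSemigroup)
  open import Data.Integer.Tactic.RingSolver using (solve-∀)
  open import Algebra.Properties.CommutativeSemigroup +-commutativeSemigroup using (interchange)

  infix  4 _≐_
  infixl 6 _⊕_ _⊖_

  _≐_ : Series → Series → Set
  A ≐ B = ∀ n i j → A n i j ≡ B n i j

  _⊕_ _⊖_ : Series → Series → Series
  (A ⊕ B) n i j = A n i j + B n i j
  (A ⊖ B) n i j = A n i j - B n i j

  -- z^c x^a q^b: the exponents come in the index order n i j of Series
  monomial : ℕ → ℕ → ℕ → Series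
  monomial c a b n i j = if (n ≡ᵇ c) ∧ (i ≡ᵇ a) ∧ (j ≡ᵇ b) then + 1 else + 0

  -- the coefficients of t^c · Σₖ f k tᵏ
  shiftSeq : ℕ → (ℕ → ℤ) → ℕ → ℤ
  shiftSeq zero    f n       = f n
  shiftSeq (suc c) f zero    = + 0
  shiftSeq (suc c) f (suc n) = shiftSeq c f n

  -- z^c x^a q^b · A
  shift : ℕ → ℕ → ℕ → Series → Series
  shift c a b A n i j = shiftSeq c (λ n′ → shiftSeq a (λ i′ → shiftSeq b (A n′ i′) j) i) n

  shiftSeq-cong : ∀ c {f g : ℕ → ℤ} → (∀ k → f k ≡ g k) → ∀ n → shiftSeq c f n ≡ shiftSeq c g n
  shiftSeq-cong zero    f≡g n       = f≡g n
  shiftSeq-cong (suc c) f≡g zero    = refl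
  shiftSeq-cong (suc c) f≡g (suc n) = shiftSeq-cong c f≡g n

  shiftSeq-+ : ∀ c (f g : ℕ → ℤ) n → shiftSeq c (λ k → f k + g k) n ≡ shiftSeq c f n + shiftSeq c g n
  shiftSeq-+ zero    f g n       = refl
  shiftSeq-+ (suc c) f g zero    = refl
  shiftSeq-+ (suc c) f g (suc n) = shiftSeq-+ c f g n

  shiftSeq-below : ∀ {c n} (f : ℕ → ℤ) → n < c → shiftSeq c f n ≡ + 0
  shiftSeq-below {suc c} {zero}  f _         = refl
  shiftSeq-below {suc c} {suc n} f (s≤s n<c) = shiftSeq-below f n<c

  shiftSeq-diagonal : ∀ n (f : ℕ → ℤ) → shiftSeq n f n ≡ f 0
  shiftSeq-diagonal zero    f = refl
  shiftSeq-diagonal (suc n) f = shiftSeq-diagonal n f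

  shiftSeq-suc : ∀ c n (f : ℕ → ℤ) → c ≢ suc n → shiftSeq c f (suc n) ≡ shiftSeq c (f ∘ suc) n
  shiftSeq-suc zero          n       f _   = refl
  shiftSeq-suc (suc zero)    zero    f c≢1 = ⊥-elim (c≢1 refl)
  shiftSeq-suc (suc (suc c)) zero    f _   = refl
  shiftSeq-suc (suc c)       (suc n) f c≢n = shiftSeq-suc c n f (c≢n ∘ cong suc)

  shift-cong : ∀ c a b {A B} → A ≐ B → shift c a b A ≐ shift c a b B
  shift-cong c a b A≐B n i j =
    shiftSeq-cong c (λ n′ → shiftSeq-cong a (λ i′ → shiftSeq-cong b (A≐B n′ i′) j) i) n

  shift-⊕ : ∀ c a b A B → shift c a b (A ⊕ B) ≐ shift c a b A ⊕ shift c a b B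
  shift-⊕ c a b A B n i j = begin
    shiftSeq c (λ n′ → shiftSeq a (λ i′ → shiftSeq b (λ j′ → A n′ i′ j′ + B n′ i′ j′) j) i) n
      ≡⟨ shiftSeq-cong c (λ n′ → shiftSeq-cong a (λ i′ → shiftSeq-+ b (A n′ i′) (B n′ i′) j) i) n ⟩
    shiftSeq c (λ n′ → shiftSeq a (λ i′ → shiftSeq b (A n′ i′) j + shiftSeq b (B n′ i′) j) i) n
      ≡⟨ shiftSeq-cong c (λ n′ → shiftSeq-+ a _ _ i) n ⟩
    shiftSeq c (λ n′ → shiftSeq a (λ i′ → shiftSeq b (A n′ i′) j) i
                     + shiftSeq a (λ i′ → shiftSeq b (B n′ i′) j) i) n
      ≡⟨ shiftSeq-+ c _ _ n ⟩
    shift c a b A n i j + shift c a b B n i j ∎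
    where open ≡-Reasoning

  sumSplits : ℕ → (ℕ → ℕ → ℤ) → ℤ
  sumSplits n h = sumℤ (map (λ p → h (proj₁ p) (proj₂ p)) (splits n))

  sumSplits-suc : ∀ n h → sumSplits (suc n) h ≡ h 0 (suc n) + sumSplits n (λ k l → h (suc k) l)
  sumSplits-suc n h = cong (λ xs → h 0 (suc n) + sumℤ xs) (sym (map-∘ (splits n)))

  sumSplits-cong : ∀ n {g h} → (∀ k l → g k l ≡ h k l) → sumSplits n g ≡ sumSplits n h
  sumSplits-cong n g≡h = cong sumℤ (map-cong (λ p → g≡h (proj₁ p) (proj₂ p)) (splits n))

  sumSplits-zero : ∀ n h → (∀ k l → h k l ≡ + 0) → sumSplits n h ≡ + 0
  sumSplits-zero zero    h h≡0 = cong (_+ + 0) (h≡0 0 0)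
  sumSplits-zero (suc n) h h≡0 = begin
    sumSplits (suc n) h                              ≡⟨ sumSplits-suc n h ⟩
    h 0 (suc n) + sumSplits n (λ k l → h (suc k) l)  ≡⟨ cong₂ _+_ (h≡0 0 (suc n)) (sumSplits-zero n _ (h≡0 ∘ suc)) ⟩
    + 0                                              ∎
    where open ≡-Reasoning

  sumSplits-+ : ∀ n g h → sumSplits n (λ k l → g k l + h k l) ≡ sumSplits n g + sumSplits n h
  sumSplits-+ zero    g h = interchange (g 0 0) (h 0 0) (+ 0) (+ 0)
  sumSplits-+ (suc n) g h = begin
    sumSplits (suc n) (λ k l → g k l + h k l)
      ≡⟨ sumSplits-suc n (λ k l → g k l + h k l) ⟩
    g 0 (suc n) + h 0 (suc n) + sumSplits n (λ k l → g′ k l + h′ k l)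
      ≡⟨ cong (λ t → g 0 (suc n) + h 0 (suc n) + t) (sumSplits-+ n g′ h′) ⟩
    g 0 (suc n) + h 0 (suc n) + (sumSplits n g′ + sumSplits n h′)
      ≡⟨ interchange (g 0 (suc n)) (h 0 (suc n)) _ _ ⟩
    (g 0 (suc n) + sumSplits n g′) + (h 0 (suc n) + sumSplits n h′)
      ≡⟨ cong₂ _+_ (sumSplits-suc n g) (sumSplits-suc n h) ⟨
    sumSplits (suc n) g + sumSplits (suc n) h ∎
    where
    open ≡-Reasoning
    g′ h′ : ℕ → ℕ → ℤ
    g′ k = g (suc k)
    h′ k = h (suc k)

  sumSplits-neg : ∀ n h → sumSplits n (λ k l → - h k l) ≡ - sumSplits n h
  sumSplits-neg zero    h = sym (neg-distrib-+ (h 0 0) (+ 0))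
  sumSplits-neg (suc n) h = begin
    sumSplits (suc n) (λ k l → - h k l)    ≡⟨ sumSplits-suc n (λ k l → - h k l) ⟩
    - h 0 (suc n) + sumSplits n (λ k l → - h′ k l)
                                           ≡⟨ cong (λ t → - h 0 (suc n) + t) (sumSplits-neg n h′) ⟩
    - h 0 (suc n) + - sumSplits n h′       ≡⟨ neg-distrib-+ (h 0 (suc n)) _ ⟨
    - (h 0 (suc n) + sumSplits n h′)       ≡⟨ cong -_ (sumSplits-suc n h) ⟨
    - sumSplits (suc n) h                  ∎
    where
    open ≡-Reasoning
    h′ : ℕ → ℕ → ℤ
    h′ k = h (suc k)

  sumSplits-single : ∀ c n h → (∀ k l → l ≢ c → h k l ≡ + 0) → sumSplits n h ≡ shiftSeq c (λ k → h k c) n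
  sumSplits-single zero    zero    h off = +-identityʳ (h 0 0)
  sumSplits-single (suc c) zero    h off = cong (_+ + 0) (off 0 0 λ ())
  sumSplits-single c       (suc n) h off with c ≟ suc n
  ... | yes refl = begin
    sumSplits (suc n) h
      ≡⟨ sumSplits-suc n h ⟩
    h 0 (suc n) + sumSplits n (λ k l → h (suc k) l)
      ≡⟨ cong (λ t → h 0 (suc n) + t) (sumSplits-single (suc n) n _ (off ∘ suc)) ⟩
    h 0 (suc n) + shiftSeq (suc n) (λ k → h (suc k) (suc n)) n
      ≡⟨ cong (λ t → h 0 (suc n) + t) (shiftSeq-below _ (n<1+n n)) ⟩
    h 0 (suc n) + + 0
      ≡⟨ +-identityʳ _ ⟩
    h 0 (suc n)
      ≡⟨ shiftSeq-diagonal n _ ⟨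
    shiftSeq (suc n) (λ k → h k (suc n)) (suc n) ∎
    where open ≡-Reasoning
  ... | no c≢1+n = begin
    sumSplits (suc n) h
      ≡⟨ sumSplits-suc n h ⟩
    h 0 (suc n) + sumSplits n (λ k l → h (suc k) l)
      ≡⟨ cong₂ _+_ (off 0 (suc n) (c≢1+n ∘ sym)) (sumSplits-single c n _ (off ∘ suc)) ⟩
    + 0 + shiftSeq c (λ k → h (suc k) c) n
      ≡⟨ +-identityˡ _ ⟩
    shiftSeq c (λ k → h (suc k) c) n
      ≡⟨ shiftSeq-suc c n _ c≢1+n ⟨
    shiftSeq c (λ k → h k c) (suc n) ∎
    where open ≡-Reasoning

  sumℤ-++ : ∀ xs ys → sumℤ (xs ++ ys) ≡ sumℤ xs + sumℤ ys
  sumℤ-++ []       ys = sym (+-identityˡ (sumℤ ys))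
  sumℤ-++ (x ∷ xs) ys = trans (cong (λ t → x + t) (sumℤ-++ xs ys)) (sym (+-assoc x _ _))

  sumℤ-concatMap : ∀ (f : A → List ℤ) xs → sumℤ (concatMap f xs) ≡ sumℤ (map (sumℤ ∘ f) xs)
  sumℤ-concatMap f []       = refl
  sumℤ-concatMap f (x ∷ xs) = trans (sumℤ-++ (f x) (concatMap f xs)) (cong (λ t → sumℤ (f x) + t) (sumℤ-concatMap f xs))

  sumSplits³ : ℕ → ℕ → ℕ → (ℕ → ℕ → ℕ → ℕ → ℕ → ℕ → ℤ) → ℤ
  sumSplits³ n i j h =
    sumSplits n λ n₁ n₂ → sumSplits i λ i₁ i₂ → sumSplits j λ j₁ j₂ → h n₁ i₁ j₁ n₂ i₂ j₂

  sumSplits³-cong : ∀ n i j {g h} → (∀ n₁ i₁ j₁ n₂ i₂ j₂ → g n₁ i₁ j₁ n₂ i₂ j₂ ≡ h n₁ i₁ j₁ n₂ i₂ j₂) →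
    sumSplits³ n i j g ≡ sumSplits³ n i j h
  sumSplits³-cong n i j g≡h =
    sumSplits-cong n λ n₁ n₂ → sumSplits-cong i λ i₁ i₂ → sumSplits-cong j λ j₁ j₂ → g≡h n₁ i₁ j₁ n₂ i₂ j₂

  sumSplits³-+ : ∀ n i j g h →
    sumSplits³ n i j (λ n₁ i₁ j₁ n₂ i₂ j₂ → g n₁ i₁ j₁ n₂ i₂ j₂ + h n₁ i₁ j₁ n₂ i₂ j₂)
    ≡ sumSplits³ n i j g + sumSplits³ n i j h
  sumSplits³-+ n i j g h =
    trans (sumSplits-cong n λ n₁ n₂ →
             trans (sumSplits-cong i λ i₁ i₂ → sumSplits-+ j _ _) (sumSplits-+ i _ _))
          (sumSplits-+ n _ _)

  sumSplits³-neg : ∀ n i j h →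
    sumSplits³ n i j (λ n₁ i₁ j₁ n₂ i₂ j₂ → - h n₁ i₁ j₁ n₂ i₂ j₂) ≡ - sumSplits³ n i j h
  sumSplits³-neg n i j h =
    trans (sumSplits-cong n λ n₁ n₂ →
             trans (sumSplits-cong i λ i₁ i₂ → sumSplits-neg j _) (sumSplits-neg i _))
          (sumSplits-neg n _)

  ⊛-sumSplits³ : ∀ A B n i j →
    (A ⊛ B) n i j ≡ sumSplits³ n i j (λ n₁ i₁ j₁ n₂ i₂ j₂ → A n₁ i₁ j₁ * B n₂ i₂ j₂)
  ⊛-sumSplits³ A B n i j =
    trans (sumℤ-concatMap _ (splits n)) (cong sumℤ (map-cong (λ _ → sumℤ-concatMap _ (splits i)) (splits n)))

  ⊛-congʳ : ∀ A {B C} → B ≐ C → A ⊛ B ≐ A ⊛ C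
  ⊛-congʳ A {B} {C} B≐C n i j = begin
    (A ⊛ B) n i j
      ≡⟨ ⊛-sumSplits³ A B n i j ⟩
    sumSplits³ n i j (λ n₁ i₁ j₁ n₂ i₂ j₂ → A n₁ i₁ j₁ * B n₂ i₂ j₂)
      ≡⟨ sumSplits³-cong n i j (λ n₁ i₁ j₁ n₂ i₂ j₂ → cong (A n₁ i₁ j₁ *_) (B≐C n₂ i₂ j₂)) ⟩
    sumSplits³ n i j (λ n₁ i₁ j₁ n₂ i₂ j₂ → A n₁ i₁ j₁ * C n₂ i₂ j₂)
      ≡⟨ ⊛-sumSplits³ A C n i j ⟨
    (A ⊛ C) n i j ∎
    where open ≡-Reasoning

  ⊛-distribˡ-⊕ : ∀ A B C → A ⊛ (B ⊕ C) ≐ A ⊛ B ⊕ A ⊛ C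
  ⊛-distribˡ-⊕ A B C n i j = begin
    (A ⊛ (B ⊕ C)) n i j
      ≡⟨ ⊛-sumSplits³ A (B ⊕ C) n i j ⟩
    sumSplits³ n i j (λ n₁ i₁ j₁ n₂ i₂ j₂ → A n₁ i₁ j₁ * (B n₂ i₂ j₂ + C n₂ i₂ j₂))
      ≡⟨ sumSplits³-cong n i j (λ n₁ i₁ j₁ n₂ i₂ j₂ → *-distribˡ-+ (A n₁ i₁ j₁) _ _) ⟩
    sumSplits³ n i j (λ n₁ i₁ j₁ n₂ i₂ j₂ → A n₁ i₁ j₁ * B n₂ i₂ j₂ + A n₁ i₁ j₁ * C n₂ i₂ j₂)
      ≡⟨ sumSplits³-+ n i j _ _ ⟩
    sumSplits³ n i j (λ n₁ i₁ j₁ n₂ i₂ j₂ → A n₁ i₁ j₁ * B n₂ i₂ j₂)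
      + sumSplits³ n i j (λ n₁ i₁ j₁ n₂ i₂ j₂ → A n₁ i₁ j₁ * C n₂ i₂ j₂)
      ≡⟨ cong₂ _+_ (⊛-sumSplits³ A B n i j) (⊛-sumSplits³ A C n i j) ⟨
    (A ⊛ B) n i j + (A ⊛ C) n i j ∎
    where open ≡-Reasoning

  ⊛-distribˡ-⊖ : ∀ A B C → A ⊛ (B ⊖ C) ≐ A ⊛ B ⊖ A ⊛ C
  ⊛-distribˡ-⊖ A B C n i j = begin
    (A ⊛ (B ⊖ C)) n i j
      ≡⟨ ⊛-sumSplits³ A (B ⊖ C) n i j ⟩
    sumSplits³ n i j (λ n₁ i₁ j₁ n₂ i₂ j₂ → A n₁ i₁ j₁ * (B n₂ i₂ j₂ - C n₂ i₂ j₂))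
      ≡⟨ sumSplits³-cong n i j (λ n₁ i₁ j₁ n₂ i₂ j₂ → distrib (A n₁ i₁ j₁) _ _) ⟩
    sumSplits³ n i j (λ n₁ i₁ j₁ n₂ i₂ j₂ → A n₁ i₁ j₁ * B n₂ i₂ j₂ + - (A n₁ i₁ j₁ * C n₂ i₂ j₂))
      ≡⟨ sumSplits³-+ n i j _ _ ⟩
    AB + sumSplits³ n i j (λ n₁ i₁ j₁ n₂ i₂ j₂ → - (A n₁ i₁ j₁ * C n₂ i₂ j₂))
      ≡⟨ cong (λ t → AB + t) (sumSplits³-neg n i j _) ⟩
    AB - sumSplits³ n i j (λ n₁ i₁ j₁ n₂ i₂ j₂ → A n₁ i₁ j₁ * C n₂ i₂ j₂)
      ≡⟨ cong₂ _-_ (⊛-sumSplits³ A B n i j) (⊛-sumSplits³ A C n i j) ⟨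
    (A ⊛ B) n i j - (A ⊛ C) n i j ∎
    where
    open ≡-Reasoning
    AB = sumSplits³ n i j (λ n₁ i₁ j₁ n₂ i₂ j₂ → A n₁ i₁ j₁ * B n₂ i₂ j₂)
    distrib : ∀ x y z → x * (y - z) ≡ x * y + - (x * z)
    distrib = solve-∀

  ⊛-monomial : ∀ A c a b → A ⊛ monomial c a b ≐ shift c a b A
  ⊛-monomial A c a b n i j = begin
    (A ⊛ monomial c a b) n i j
      ≡⟨ ⊛-sumSplits³ A (monomial c a b) n i j ⟩
    sumSplits n (λ n₁ n₂ → sumSplits i λ i₁ i₂ → sumSplits j λ j₁ j₂ → A n₁ i₁ j₁ * monomial c a b n₂ i₂ j₂)
      ≡⟨ sumSplits-single c n _ (λ n₁ n₂ n₂≢c →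
           sumSplits-zero i _ λ i₁ i₂ → sumSplits-zero j _ λ j₁ j₂ → vanish (A n₁ i₁ j₁) (offᶻ i₂ j₂ n₂≢c)) ⟩
    shiftSeq c (λ n₁ → sumSplits i λ i₁ i₂ → sumSplits j λ j₁ j₂ → A n₁ i₁ j₁ * monomial c a b c i₂ j₂) n
      ≡⟨ shiftSeq-cong c (λ n₁ → sumSplits-single a i _ λ i₁ i₂ i₂≢a →
           sumSplits-zero j _ λ j₁ j₂ → vanish (A n₁ i₁ j₁) (offˣ j₂ i₂≢a)) n ⟩
    shiftSeq c (λ n₁ → shiftSeq a (λ i₁ → sumSplits j λ j₁ j₂ → A n₁ i₁ j₁ * monomial c a b c a j₂) i) n
      ≡⟨ shiftSeq-cong c (λ n₁ → shiftSeq-cong a (λ i₁ → sumSplits-single b j _ λ j₁ j₂ j₂≢b →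
           vanish (A n₁ i₁ j₁) (offᵠ j₂≢b)) i) n ⟩
    shiftSeq c (λ n₁ → shiftSeq a (λ i₁ → shiftSeq b (λ j₁ → A n₁ i₁ j₁ * monomial c a b c a b) j) i) n
      ≡⟨ shiftSeq-cong c (λ n₁ → shiftSeq-cong a (λ i₁ → shiftSeq-cong b (λ j₁ →
           trans (cong (A n₁ i₁ j₁ *_) on) (*-identityʳ _)) j) i) n ⟩
    shift c a b A n i j ∎
    where
    open ≡-Reasoning
    vanish : ∀ x {m} → m ≡ + 0 → x * m ≡ + 0
    vanish x refl = *-zeroʳ x
    offᶻ : ∀ {n} i j → n ≢ c → monomial c a b n i j ≡ + 0
    offᶻ _ _ n≢c rewrite ≢⇒≡ᵇ≡false n≢c = refl
    offˣ : ∀ {i} j → i ≢ a → monomial c a b c i j ≡ + 0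
    offˣ _ i≢a rewrite ≡ᵇ-refl c | ≢⇒≡ᵇ≡false i≢a = refl
    offᵠ : ∀ {j} → j ≢ b → monomial c a b c a j ≡ + 0
    offᵠ j≢b rewrite ≡ᵇ-refl c | ≡ᵇ-refl a | ≢⇒≡ᵇ≡false j≢b = refl
    on : monomial c a b c a b ≡ + 1
    on rewrite ≡ᵇ-refl c | ≡ᵇ-refl a | ≡ᵇ-refl b = refl

  denom≐ : denom ≐ monomial 0 0 0 ⊖ monomial 1 1 0 ⊖ monomial 1 0 1 ⊕ monomial 2 1 1 ⊖ monomial 2 0 1
  denom≐ 0                   0             0             = refl
  denom≐ 0                   0             (suc j)       = refl
  denom≐ 0                   (suc i)       j             = refl
  denom≐ 1                   0             0             = refl
  denom≐ 1                   0             1             = refl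
  denom≐ 1                   0             (suc (suc j)) = refl
  denom≐ 1                   1             0             = refl
  denom≐ 1                   1             (suc j)       = refl
  denom≐ 1                   (suc (suc i)) j             = refl
  denom≐ 2                   0             0             = refl
  denom≐ 2                   0             1             = refl
  denom≐ 2                   0             (suc (suc j)) = refl
  denom≐ 2                   1             0             = refl
  denom≐ 2                   1             1             = refl
  denom≐ 2                   1             (suc (suc j)) = refl
  denom≐ 2                   (suc (suc i)) j             = refl
  denom≐ (suc (suc (suc n))) i             j             = refl

  numer≐ : numer ≐ monomial 0 0 0 ⊖ monomial 1 0 1
  numer≐ 0             0       0             = refl
  numer≐ 0             0       (suc j)       = refl
  numer≐ 0             (suc i) j             = refl
  numer≐ 1             0       0             = refl
  numer≐ 1             0       1             = refl
  numer≐ 1             0       (suc (suc j)) = refl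
  numer≐ 1             (suc i) j             = refl
  numer≐ (suc (suc n)) i       j             = refl

  ⊛-denom : ∀ A → A ⊛ denom ≐ A ⊖ shift 1 1 0 A ⊖ shift 1 0 1 A ⊕ shift 2 1 1 A ⊖ shift 2 0 1 A
  ⊛-denom A n i j = begin
    A⊛ denom
      ≡⟨ ⊛-congʳ A denom≐ n i j ⟩
    A⊛ (m₀₀₀ ⊖ m₁₁₀ ⊖ m₁₀₁ ⊕ m₂₁₁ ⊖ m₂₀₁)
      ≡⟨ ⊛-distribˡ-⊖ A (m₀₀₀ ⊖ m₁₁₀ ⊖ m₁₀₁ ⊕ m₂₁₁) m₂₀₁ n i j ⟩
    A⊛ (m₀₀₀ ⊖ m₁₁₀ ⊖ m₁₀₁ ⊕ m₂₁₁) - A⊛ m₂₀₁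
      ≡⟨ cong (_- A⊛ m₂₀₁) (⊛-distribˡ-⊕ A (m₀₀₀ ⊖ m₁₁₀ ⊖ m₁₀₁) m₂₁₁ n i j) ⟩
    A⊛ (m₀₀₀ ⊖ m₁₁₀ ⊖ m₁₀₁) + A⊛ m₂₁₁ - A⊛ m₂₀₁
      ≡⟨ cong (λ t → t + A⊛ m₂₁₁ - A⊛ m₂₀₁) (⊛-distribˡ-⊖ A (m₀₀₀ ⊖ m₁₁₀) m₁₀₁ n i j) ⟩
    A⊛ (m₀₀₀ ⊖ m₁₁₀) - A⊛ m₁₀₁ + A⊛ m₂₁₁ - A⊛ m₂₀₁
      ≡⟨ cong (λ t → t - A⊛ m₁₀₁ + A⊛ m₂₁₁ - A⊛ m₂₀₁) (⊛-distribˡ-⊖ A m₀₀₀ m₁₁₀ n i j) ⟩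
    A⊛ m₀₀₀ - A⊛ m₁₁₀ - A⊛ m₁₀₁ + A⊛ m₂₁₁ - A⊛ m₂₀₁
      ≡⟨ cong₂ _-_ (cong₂ _+_ (cong₂ _-_ (cong₂ _-_ (⊛-monomial A 0 0 0 n i j) (⊛-monomial A 1 1 0 n i j))
                                         (⊛-monomial A 1 0 1 n i j))
                              (⊛-monomial A 2 1 1 n i j))
                   (⊛-monomial A 2 0 1 n i j) ⟩
    (A ⊖ shift 1 1 0 A ⊖ shift 1 0 1 A ⊕ shift 2 1 1 A ⊖ shift 2 0 1 A) n i j ∎
    where
    open ≡-Reasoning
    A⊛ : Series → ℤ
    A⊛ B = (A ⊛ B) n i j
    m₀₀₀ = monomial 0 0 0
    m₁₁₀ = monomial 1 1 0
    m₁₀₁ = monomial 1 0 1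
    m₂₁₁ = monomial 2 1 1
    m₂₀₁ = monomial 2 0 1

  qz·xz : ∀ A → shift 1 0 1 (shift 1 1 0 A) ≐ shift 2 1 1 A
  qz·xz A zero          i       j       = refl
  qz·xz A (suc zero)    i       zero    = refl
  qz·xz A (suc (suc n)) zero    zero    = refl
  qz·xz A (suc (suc n)) (suc i) zero    = refl
  qz·xz A (suc n)       i       (suc j) = refl

  qz·1 : shift 1 0 1 (monomial 0 0 0) ≐ monomial 1 0 1
  qz·1 zero          i       j             = refl
  qz·1 (suc zero)    zero    zero          = refl
  qz·1 (suc zero)    zero    (suc zero)    = refl
  qz·1 (suc zero)    zero    (suc (suc j)) = refl
  qz·1 (suc zero)    (suc i) zero          = refl
  qz·1 (suc zero)    (suc i) (suc j)       = refl
  qz·1 (suc (suc n)) i       zero          = refl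
  qz·1 (suc (suc n)) i       (suc j)       = refl

  ⊛-denom≐numer : ∀ A N →
    A ≐ monomial 0 0 0 ⊕ shift 1 1 0 A ⊕ N →
    N ≐ shift 1 0 1 N ⊕ shift 2 0 1 A →
    A ⊛ denom ≐ numer
  ⊛-denom≐numer A N A≐ N≐ n i j = begin
    (A ⊛ denom) n i j
      ≡⟨ ⊛-denom A n i j ⟩
    (A ⊖ shift 1 1 0 A ⊖ shift 1 0 1 A ⊕ shift 2 1 1 A ⊖ shift 2 0 1 A) n i j
      ≡⟨ cancel {one = monomial 0 0 0 n i j} {qz = monomial 1 0 1 n i j} {qzN = shift 1 0 1 N n i j}
                (A≐ n i j) qzA≐ (N≐ n i j) ⟩
    (monomial 0 0 0 ⊖ monomial 1 0 1) n i j
      ≡⟨ numer≐ n i j ⟨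
    numer n i j ∎
    where
    open ≡-Reasoning
    qzA≐ : shift 1 0 1 A n i j ≡ monomial 1 0 1 n i j + shift 2 1 1 A n i j + shift 1 0 1 N n i j
    qzA≐ = begin
      shift 1 0 1 A n i j
        ≡⟨ shift-cong 1 0 1 A≐ n i j ⟩
      shift 1 0 1 (monomial 0 0 0 ⊕ shift 1 1 0 A ⊕ N) n i j
        ≡⟨ shift-⊕ 1 0 1 (monomial 0 0 0 ⊕ shift 1 1 0 A) N n i j ⟩
      shift 1 0 1 (monomial 0 0 0 ⊕ shift 1 1 0 A) n i j + shift 1 0 1 N n i j
        ≡⟨ cong (_+ shift 1 0 1 N n i j) (shift-⊕ 1 0 1 (monomial 0 0 0) (shift 1 1 0 A) n i j) ⟩
      shift 1 0 1 (monomial 0 0 0) n i j + shift 1 0 1 (shift 1 1 0 A) n i j + shift 1 0 1 N n i j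
        ≡⟨ cong (_+ shift 1 0 1 N n i j) (cong₂ _+_ (qz·1 n i j) (qz·xz A n i j)) ⟩
      monomial 1 0 1 n i j + shift 2 1 1 A n i j + shift 1 0 1 N n i j ∎
    cancel : ∀ {a xzA qzA xqz²A qz²A one qz N qzN} →
      a ≡ one + xzA + N → qzA ≡ qz + xqz²A + qzN → N ≡ qzN + qz²A →
      a - xzA - qzA + xqz²A - qz²A ≡ one - qz
    cancel {xzA = xzA} {xqz²A = xqz²A} {qz²A} {one} {qz} {qzN = qzN} refl refl refl =
      identity one xzA qzN qz²A qz xqz²A
      where
      identity : ∀ one xzA qzN qz²A qz xqz²A →
        one + xzA + (qzN + qz²A) - xzA - (qz + xqz²A + qzN) + xqz²A - qz²A ≡ one - qz
      identity = solve-∀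

open PowerSeries

open import Algebra.Properties.CommutativeSemigroup Data.Nat.Properties.+-commutativeSemigroup using (x∙yz≈y∙xz)
open import Data.Integer using (+_) renaming (_+_ to _+ℤ_)
open import Data.Integer.Properties using (pos-+) renaming (+-identityˡ to +ℤ-identityˡ; +-comm to +ℤ-comm)
open import Data.Nat using (_+_)
open import Data.Nat.Properties using (+-suc; +-comm; +-identityʳ)
open import Data.Nat.Tactic.RingSolver using (solve-∀)

any-++ : ∀ (p : A → Bool) xs ys → any p (xs ++ ys) ≡ any p xs ∨ any p ys
any-++ p []       ys = refl
any-++ p (x ∷ xs) ys = trans (cong (p x ∨_) (any-++ p xs ys)) (sym (∨-assoc (p x) _ _))

any-map : ∀ (p : B → Bool) (f : A → B) xs → any p (map f xs) ≡ any (p ∘ f) xs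
any-map p f xs = cong or (sym (map-∘ xs))

any-∨ : ∀ (p q : A → Bool) xs → any (λ x → p x ∨ q x) xs ≡ any p xs ∨ any q xs
any-∨ p q []       = refl
any-∨ p q (x ∷ xs) = trans (cong ((p x ∨ q x) ∨_) (any-∨ p q xs)) (∨-interchange (p x) (q x) (any p xs) (any q xs))

any-const-false : ∀ (p : A → Bool) → (∀ x → p x ≡ false) → ∀ xs → any p xs ≡ false
any-const-false p p≡false []       = refl
any-const-false p p≡false (x ∷ xs) = trans (cong (_∨ any p xs) (p≡false x)) (any-const-false p p≡false xs)

filterᵇ-cong-All : ∀ {p q : A → Bool} {xs} → All (λ x → p x ≡ q x) xs → filterᵇ p xs ≡ filterᵇ q xs
filterᵇ-cong-All                  []            = refl
filterᵇ-cong-All {q = q} {x ∷ xs} (px≡qx ∷ eqs) rewrite px≡qx with q x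
... | true  = cong (x ∷_) (filterᵇ-cong-All eqs)
... | false = filterᵇ-cong-All eqs

filterᵇ-map : ∀ (p : B → Bool) (f : A → B) xs → filterᵇ p (map f xs) ≡ map f (filterᵇ (p ∘ f) xs)
filterᵇ-map p f []       = refl
filterᵇ-map p f (x ∷ xs) with p (f x)
... | true  = cong (f x ∷_) (filterᵇ-map p f xs)
... | false = filterᵇ-map p f xs

filterᵇ-concatMap : ∀ (p : B → Bool) (f : A → List B) xs →
  filterᵇ p (concatMap f xs) ≡ concatMap (filterᵇ p ∘ f) xs
filterᵇ-concatMap p f []       = refl
filterᵇ-concatMap p f (x ∷ xs) =
  trans (filter-++ (T? ∘ p) (f x) (concatMap f xs)) (cong (filterᵇ p (f x) ++_) (filterᵇ-concatMap p f xs))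

filterᵇ-not-∨ : ∀ (p : A → Bool) β xs →
  filterᵇ (λ x → not (β ∨ p x)) xs ≡ (if β then [] else filterᵇ (not ∘ p) xs)
filterᵇ-not-∨ p true  []       = refl
filterᵇ-not-∨ p true  (x ∷ xs) = filterᵇ-not-∨ p true xs
filterᵇ-not-∨ p false xs       = refl

concatMap-if-[] : ∀ (p : A → Bool) (f : A → List B) xs →
  concatMap (λ x → if p x then [] else f x) xs ≡ concatMap f (filterᵇ (not ∘ p) xs)
concatMap-if-[] p f []       = refl
concatMap-if-[] p f (x ∷ xs) with p x
... | true  = concatMap-if-[] p f xs
... | false = cong (f x ++_) (concatMap-if-[] p f xs)

count : (A → Bool) → List A → ℕ
count p xs = length (filterᵇ p xs)

count-∷ : ∀ (p : A → Bool) x xs → count p (x ∷ xs) ≡ 𝟙 (p x) + count p xs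
count-∷ p x xs with p x
... | true  = refl
... | false = refl

count-map : ∀ (p : B → Bool) (f : A → B) xs → count p (map f xs) ≡ count (p ∘ f) xs
count-map p f xs = trans (cong length (filterᵇ-map p f xs)) (length-map f (filterᵇ (p ∘ f) xs))

count-cong : ∀ {p q : A → Bool} → (∀ x → p x ≡ q x) → ∀ xs → count p xs ≡ count q xs
count-cong p≡q xs = cong length (filterᵇ-cong-All (All.universal p≡q xs))

count-none : ∀ {p : A → Bool} → (∀ x → p x ≡ false) → ∀ xs → count p xs ≡ 0
count-none p≡false []       = refl
count-none p≡false (x ∷ xs) rewrite p≡false x = count-none p≡false xs

count-split : ∀ (q p : A → Bool) xs →
  count p xs ≡ count (λ x → q x ∧ p x) xs + count (λ x → not (q x) ∧ p x) xs
count-split q p []       = refl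
count-split q p (x ∷ xs) with q x | p x
... | true  | true  = cong suc (count-split q p xs)
... | true  | false = count-split q p xs
... | false | true  = trans (cong suc (count-split q p xs)) (sym (+-suc _ _))
... | false | false = count-split q p xs

-- Pattern containment

++-unique : ∀ {ys : List A} (f : List A → List A) →
  f [] ≡ ys → (∀ x xs → f (x ∷ xs) ≡ x ∷ f xs) → ∀ xs → f xs ≡ xs ++ ys
++-unique f f[] f∷ []       = f[]
++-unique f f[] f∷ (x ∷ xs) = trans (f∷ x xs) (cong (x ∷_) (++-unique f f[] f∷ xs))

-- `subseqs` appends with a `where`-bound copy of `_++_` that cannot be named here; the meta
-- `appendSubseqs` is solved to it by unification.  (`List._∷_` is qualified because an
-- overloaded constructor cannot be inferred in a `with`.)
mutual
  private
    appendSubseqs : ℕ → List ℕ → List (List ℕ) → List (List ℕ) → List (List ℕ)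
    appendSubseqs = _

  subseqs-∷ : ∀ a as → subseqs (a ∷ as) ≡ map (a ∷_) (subseqs as) ++ subseqs as
  subseqs-∷ a as with subseqs as
  ... | S with map (a List.∷_) S
  ... | X = ++-unique (appendSubseqs a as S) refl (λ _ _ → refl) X

any-subseqs-∷ : ∀ (p : List ℕ → Bool) a as →
  any p (subseqs (a ∷ as)) ≡ any (p ∘ (a ∷_)) (subseqs as) ∨ any p (subseqs as)
any-subseqs-∷ p a as = begin
  any p (subseqs (a ∷ as))                              ≡⟨ cong (any p) (subseqs-∷ a as) ⟩
  any p (map (a ∷_) (subseqs as) ++ subseqs as)          ≡⟨ any-++ p (map (a ∷_) (subseqs as)) _ ⟩
  any p (map (a ∷_) (subseqs as)) ∨ any p (subseqs as)   ≡⟨ cong (_∨ _) (any-map p (a ∷_) (subseqs as)) ⟩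
  any (p ∘ (a ∷_)) (subseqs as) ∨ any p (subseqs as)     ∎
  where open ≡-Reasoning

any-subseqs-only-[] : ∀ (p : List ℕ → Bool) → (∀ x s → p (x ∷ s) ≡ false) →
  ∀ xs → any p (subseqs xs) ≡ p []
any-subseqs-only-[] p p∷≡false []       = ∨-identityʳ (p [])
any-subseqs-only-[] p p∷≡false (x ∷ xs) =
  trans (any-subseqs-∷ p x xs)
        (cong₂ _∨_ (any-const-false _ (p∷≡false x) (subseqs xs)) (any-subseqs-only-[] p p∷≡false xs))

patterns : List (List ℕ)
patterns = (3 ∷ 1 ∷ 2 ∷ []) ∷ (3 ∷ 2 ∷ 1 ∷ []) ∷ []

is312or321 : List ℕ → Bool
is312or321 s = listEq (std s) (3 ∷ 1 ∷ 2 ∷ []) ∨ listEq (std s) (3 ∷ 2 ∷ 1 ∷ [])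

listEq⇒length≡ : ∀ xs ys → listEq xs ys ≡ true → length xs ≡ length ys
listEq⇒length≡ []       []       _ = refl
listEq⇒length≡ (x ∷ xs) (y ∷ ys) h with x ≡ᵇ y
... | true = cong suc (listEq⇒length≡ xs ys h)

length≢3⇒is312or321≡false : ∀ s → length s ≢ 3 → is312or321 s ≡ false
length≢3⇒is312or321≡false s ≢3
  with listEq (std s) (3 ∷ 1 ∷ 2 ∷ []) in h₁ | listEq (std s) (3 ∷ 2 ∷ 1 ∷ []) in h₂
... | true  | _     = ⊥-elim (≢3 (trans (sym (length-map _ s)) (listEq⇒length≡ (std s) _ h₁)))
... | false | true  = ⊥-elim (≢3 (trans (sym (length-map _ s)) (listEq⇒length≡ (std s) _ h₂)))
... | false | false = refl

is312or321-triple : ∀ a b c → b ≢ c → is312or321 (a ∷ b ∷ c ∷ []) ≡ (b <ᵇ a) ∧ (c <ᵇ a)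
is312or321-triple a b c b≢c rewrite <ᵇ-irrefl a | <ᵇ-irrefl b | <ᵇ-irrefl c
  with b <ᵇ a in b<a | c <ᵇ a in c<a
... | false | false = refl
... | false | true  = refl
... | true  | false = refl
... | true  | true  rewrite <ᵇ-asym b a b<a | <ᵇ-asym c a c<a with b <ᵇ c in b<c
...   | true  rewrite <ᵇ-asym b c b<c = refl
...   | false rewrite <ᵇ-connex b c b≢c b<c = refl

any-<ᵇ : ∀ a xs → any (_<ᵇ a) xs ≡ (0 <ᵇ countLess a xs)
any-<ᵇ a []       = refl
any-<ᵇ a (x ∷ xs) with x <ᵇ a
... | true  = refl
... | false = any-<ᵇ a xs

any-is312or321-∷∷ : ∀ a b bs → All (b ≢_) bs →
  any (λ s → is312or321 (a ∷ b ∷ s)) (subseqs bs) ≡ (b <ᵇ a) ∧ any (_<ᵇ a) bs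
any-is312or321-∷∷ a b [] [] =
  trans (∨-identityʳ _) (trans (length≢3⇒is312or321≡false (a ∷ b ∷ []) (λ ())) (sym (∧-zeroʳ (b <ᵇ a))))
any-is312or321-∷∷ a b (c ∷ cs) (b≢c ∷ b∉cs) = begin
  any (λ s → is312or321 (a ∷ b ∷ s)) (subseqs (c ∷ cs))
    ≡⟨ any-subseqs-∷ _ c cs ⟩
  any (λ s → is312or321 (a ∷ b ∷ c ∷ s)) (subseqs cs) ∨ any (λ s → is312or321 (a ∷ b ∷ s)) (subseqs cs)
    ≡⟨ cong₂ _∨_ (any-subseqs-only-[] _ (λ d s → length≢3⇒is312or321≡false (a ∷ b ∷ c ∷ d ∷ s) (λ ())) cs)
                 (any-is312or321-∷∷ a b cs b∉cs) ⟩
  is312or321 (a ∷ b ∷ c ∷ []) ∨ ((b <ᵇ a) ∧ any (_<ᵇ a) cs)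
    ≡⟨ cong (_∨ _) (is312or321-triple a b c b≢c) ⟩
  ((b <ᵇ a) ∧ (c <ᵇ a)) ∨ ((b <ᵇ a) ∧ any (_<ᵇ a) cs)
    ≡⟨ ∧-distribˡ-∨ (b <ᵇ a) _ _ ⟨
  (b <ᵇ a) ∧ any (_<ᵇ a) (c ∷ cs) ∎
  where open ≡-Reasoning

any-is312or321-∷ : ∀ a as → Unique as →
  any (λ s → is312or321 (a ∷ s)) (subseqs as) ≡ (1 <ᵇ countLess a as)
any-is312or321-∷ a []       []              = trans (∨-identityʳ _) (length≢3⇒is312or321≡false (a ∷ []) (λ ()))
any-is312or321-∷ a (b ∷ bs) (b∉bs ∷ unique) = begin
  any (λ s → is312or321 (a ∷ s)) (subseqs (b ∷ bs))
    ≡⟨ any-subseqs-∷ _ b bs ⟩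
  any (λ s → is312or321 (a ∷ b ∷ s)) (subseqs bs) ∨ any (λ s → is312or321 (a ∷ s)) (subseqs bs)
    ≡⟨ cong₂ _∨_ (any-is312or321-∷∷ a b bs b∉bs) (any-is312or321-∷ a bs unique) ⟩
  ((b <ᵇ a) ∧ any (_<ᵇ a) bs) ∨ (1 <ᵇ countLess a bs)
    ≡⟨ cong (λ t → ((b <ᵇ a) ∧ t) ∨ (1 <ᵇ countLess a bs)) (any-<ᵇ a bs) ⟩
  ((b <ᵇ a) ∧ (0 <ᵇ countLess a bs)) ∨ (1 <ᵇ countLess a bs)
    ≡⟨ atLeastTwo (b <ᵇ a) (countLess a bs) ⟩
  (1 <ᵇ countLess a (b ∷ bs)) ∎
  where
  open ≡-Reasoning
  atLeastTwo : ∀ β k → (β ∧ (0 <ᵇ k)) ∨ (1 <ᵇ k) ≡ (1 <ᵇ 𝟙 β + k)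
  atLeastTwo true  zero    = refl
  atLeastTwo true  (suc k) = refl
  atLeastTwo false k       = refl

twoSmallerAfter : List ℕ → Bool
twoSmallerAfter []       = false
twoSmallerAfter (a ∷ as) = (1 <ᵇ countLess a as) ∨ twoSmallerAfter as

any-is312or321-subseqs : ∀ π → Unique π → any is312or321 (subseqs π) ≡ twoSmallerAfter π
any-is312or321-subseqs []       []           = refl
any-is312or321-subseqs (a ∷ as) (_ ∷ unique) =
  trans (any-subseqs-∷ is312or321 a as)
        (cong₂ _∨_ (any-is312or321-∷ a as unique) (any-is312or321-subseqs as unique))

avoidsAll-patterns : ∀ π → Unique π → avoidsAll π patterns ≡ not (twoSmallerAfter π)
avoidsAll-patterns π unique = begin
  avoidsAll π patterns
    ≡⟨ neither (contains π (3 ∷ 1 ∷ 2 ∷ [])) (contains π (3 ∷ 2 ∷ 1 ∷ [])) ⟩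
  not (contains π (3 ∷ 1 ∷ 2 ∷ []) ∨ contains π (3 ∷ 2 ∷ 1 ∷ []))
    ≡⟨ cong not (any-∨ _ _ (subseqs π)) ⟨
  not (any is312or321 (subseqs π))
    ≡⟨ cong not (any-is312or321-subseqs π unique) ⟩
  not (twoSmallerAfter π) ∎
  where
  open ≡-Reasoning
  neither : ∀ x y → ((if x then false else true) ∧ ((if y then false else true) ∧ true)) ≡ not (x ∨ y)
  neither true  y     = refl
  neither false true  = refl
  neither false false = refl

-- Inserting a new maximum

lastTwo : ℕ → List ℕ → List (List ℕ)
lastTwo m []           = (m ∷ []) ∷ []
lastTwo m (b ∷ [])     = (m ∷ b ∷ []) ∷ (b ∷ m ∷ []) ∷ []
lastTwo m (b ∷ c ∷ cs) = map (b ∷_) (lastTwo m (c ∷ cs))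

countLess-insertions : ∀ b m xs → (m <ᵇ b) ≡ false →
  All (λ w → countLess b w ≡ countLess b xs) (insertions m xs)
countLess-insertions b m []       m≮b = cong (λ t → 𝟙 t + 0) m≮b ∷ []
countLess-insertions b m (c ∷ cs) m≮b =
  cong (λ t → 𝟙 t + countLess b (c ∷ cs)) m≮b
  ∷ map⁺ (All.map (cong (λ k → 𝟙 (c <ᵇ b) + k)) (countLess-insertions b m cs m≮b))

avoiding-insertions : ∀ m π → All (_< m) π →
  filterᵇ (not ∘ twoSmallerAfter) (insertions m π) ≡ (if twoSmallerAfter π then [] else lastTwo m π)
avoiding-insertions m []           []          = refl
avoiding-insertions m (b ∷ [])     (b<m ∷ [])  rewrite <⇒<ᵇ≡true b<m | ≥⇒<ᵇ≡false (<⇒≤ b<m) = refl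
avoiding-insertions m (b ∷ c ∷ cs) (b<m ∷ c∷cs<m@(c<m ∷ _)) = begin
  filterᵇ avoiding ((m ∷ b ∷ c ∷ cs) ∷ map (b ∷_) W)
    ≡⟨ filter-reject (T? ∘ avoiding) {x = m ∷ b ∷ c ∷ cs} {xs = map (b ∷_) W} (subst T m∷b∷c∷cs-rejected) ⟩
  filterᵇ avoiding (map (b ∷_) W)
    ≡⟨ filterᵇ-map avoiding (b ∷_) W ⟩
  map (b ∷_) (filterᵇ (avoiding ∘ (b ∷_)) W)
    ≡⟨ cong (map (b ∷_)) (filterᵇ-cong-All (All.map (cong (λ k → not ((1 <ᵇ k) ∨ _))) countLess-b)) ⟩
  map (b ∷_) (filterᵇ (λ w → not ((1 <ᵇ countLess b (c ∷ cs)) ∨ twoSmallerAfter w)) W)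
    ≡⟨ cong (map (b ∷_)) (filterᵇ-not-∨ twoSmallerAfter (1 <ᵇ countLess b (c ∷ cs)) W) ⟩
  map (b ∷_) (if 1 <ᵇ countLess b (c ∷ cs) then [] else filterᵇ avoiding W)
    ≡⟨ cong (λ L → map (b ∷_) (if 1 <ᵇ countLess b (c ∷ cs) then [] else L))
            (avoiding-insertions m (c ∷ cs) c∷cs<m) ⟩
  map (b ∷_) (if 1 <ᵇ countLess b (c ∷ cs) then [] else if twoSmallerAfter (c ∷ cs) then [] else lastTwo m (c ∷ cs))
    ≡⟨ map-if (1 <ᵇ countLess b (c ∷ cs)) (twoSmallerAfter (c ∷ cs)) ⟩
  (if twoSmallerAfter (b ∷ c ∷ cs) then [] else lastTwo m (b ∷ c ∷ cs)) ∎
  where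
  open ≡-Reasoning
  avoiding = not ∘ twoSmallerAfter
  W        = insertions m (c ∷ cs)
  countLess-b : All (λ w → countLess b w ≡ countLess b (c ∷ cs)) W
  countLess-b = countLess-insertions b m (c ∷ cs) (≥⇒<ᵇ≡false (<⇒≤ b<m))
  m∷b∷c∷cs-rejected : avoiding (m ∷ b ∷ c ∷ cs) ≡ false
  m∷b∷c∷cs-rejected rewrite <⇒<ᵇ≡true b<m | <⇒<ᵇ≡true c<m = refl
  map-if : ∀ β γ → map (b ∷_) (if β then [] else if γ then [] else lastTwo m (c ∷ cs))
                 ≡ (if β ∨ γ then [] else map (b ∷_) (lastTwo m (c ∷ cs)))
  map-if true  γ     = refl
  map-if false true  = refl
  map-if false false = refl

insertions-All : ∀ {P : ℕ → Set} m xs → P m → All P xs → All (All P) (insertions m xs)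
insertions-All m []       Pm []         = (Pm ∷ []) ∷ []
insertions-All m (x ∷ xs) Pm (Px ∷ Pxs) = (Pm ∷ Px ∷ Pxs) ∷ map⁺ (All.map (Px ∷_) (insertions-All m xs Pm Pxs))

insertions-length : ∀ m xs → All (λ w → length w ≡ suc (length xs)) (insertions m xs)
insertions-length m []       = refl ∷ []
insertions-length m (x ∷ xs) = refl ∷ map⁺ (All.map (cong suc) (insertions-length m xs))

insertions-Unique : ∀ m xs → All (m ≢_) xs → Unique xs → All Unique (insertions m xs)
insertions-Unique m []       []           []              = ([] ∷ []) ∷ []
insertions-Unique m (x ∷ xs) (m≢x ∷ m∉xs) (x∉xs ∷ unique) =
  ((m≢x ∷ m∉xs) ∷ x∉xs ∷ unique)
  ∷ map⁺ (All.zipWith (λ (x∉w , w-unique) → x∉w ∷ w-unique)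
            (insertions-All m xs (m≢x ∘ sym) x∉xs , insertions-Unique m xs m∉xs unique))

DistinctBounded : ℕ → List ℕ → Set
DistinctBounded n π = length π ≡ n × All (_< suc n) π × Unique π

perms-distinctBounded : ∀ n → All (DistinctBounded n) (perms n)
perms-distinctBounded zero    = (refl , [] , []) ∷ []
perms-distinctBounded (suc n) = concat⁺ (map⁺ (All.map insert (perms-distinctBounded n)))
  where
  insert : ∀ {π} → DistinctBounded n π → All (DistinctBounded (suc n)) (insertions (suc n) π)
  insert {π} (length≡n , bounded , unique) =
    All.zipWith (λ (length≡ , bounded′ , unique′) → trans length≡ (cong suc length≡n) , bounded′ , unique′)
      ( insertions-length (suc n) π
      , All.zip ( insertions-All (suc n) π (n<1+n (suc n)) (All.map m<n⇒m<1+n bounded)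
                , insertions-Unique (suc n) π (All.map >⇒≢ bounded) unique))

avoiders-distinctBounded : ∀ n → All (DistinctBounded n) (avoiders patterns n)
avoiders-distinctBounded n = filter⁺ (T? ∘ λ π → avoidsAll π patterns) (perms-distinctBounded n)

avoiders-suc : ∀ n → avoiders patterns (suc n) ≡ concatMap (lastTwo (suc n)) (avoiders patterns n)
avoiders-suc n = begin
  filterᵇ (λ π → avoidsAll π patterns) (concatMap (insertions (suc n)) (perms n))
    ≡⟨ filterᵇ-cong-All (avoidsAll≡ (perms-distinctBounded (suc n))) ⟩
  filterᵇ avoiding (concatMap (insertions (suc n)) (perms n))
    ≡⟨ filterᵇ-concatMap avoiding (insertions (suc n)) (perms n) ⟩
  concatMap (filterᵇ avoiding ∘ insertions (suc n)) (perms n)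
    ≡⟨ cong concat (map-cong-local (All.map (λ (_ , bounded , _) → avoiding-insertions (suc n) _ bounded)
                                            (perms-distinctBounded n))) ⟩
  concatMap (λ π → if twoSmallerAfter π then [] else lastTwo (suc n) π) (perms n)
    ≡⟨ concatMap-if-[] twoSmallerAfter (lastTwo (suc n)) (perms n) ⟩
  concatMap (lastTwo (suc n)) (filterᵇ avoiding (perms n))
    ≡⟨ cong (concatMap (lastTwo (suc n))) (filterᵇ-cong-All (avoidsAll≡ (perms-distinctBounded n))) ⟨
  concatMap (lastTwo (suc n)) (avoiders patterns n) ∎
  where
  open ≡-Reasoning
  avoiding = not ∘ twoSmallerAfter
  avoidsAll≡ : ∀ {k πs} → All (DistinctBounded k) πs → All (λ π → avoidsAll π patterns ≡ avoiding π) πs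
  avoidsAll≡ = All.map (λ (_ , _ , unique) → avoidsAll-patterns _ unique)

-- Fixed points and excedances

record Stat : Set where
  constructor mkStat
  field
    fixedBeforeLast : ℕ
    lastFixed       : Bool
    excedances      : ℕ
open Stat

fpOf : Stat → ℕ
fpOf s = 𝟙 (lastFixed s) + fixedBeforeLast s

fixedBeforeLastFrom : ℕ → List ℕ → ℕ
fixedBeforeLastFrom k []          = 0
fixedBeforeLastFrom k (a ∷ [])    = 0
fixedBeforeLastFrom k (a ∷ b ∷ w) = 𝟙 (a ≡ᵇ k) + fixedBeforeLastFrom (suc k) (b ∷ w)

lastFixedFrom : ℕ → List ℕ → Bool
lastFixedFrom k []          = false
lastFixedFrom k (a ∷ [])    = a ≡ᵇ k
lastFixedFrom k (a ∷ b ∷ w) = lastFixedFrom (suc k) (b ∷ w)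

statFrom : ℕ → List ℕ → Stat
statFrom k π = mkStat (fixedBeforeLastFrom k π) (lastFixedFrom k π) (excFrom k π)

fpFrom≡fpOf : ∀ k π → fpFrom k π ≡ fpOf (statFrom k π)
fpFrom≡fpOf k []          = refl
fpFrom≡fpOf k (a ∷ [])    = refl
fpFrom≡fpOf k (a ∷ b ∷ w) =
  trans (cong (λ t → 𝟙 (a ≡ᵇ k) + t) (fpFrom≡fpOf (suc k) (b ∷ w)))
        (x∙yz≈y∙xz (𝟙 (a ≡ᵇ k)) (𝟙 (lastFixedFrom (suc k) (b ∷ w))) _)

consStat : ℕ → ℕ → Stat → Stat
consStat k b s = mkStat (𝟙 (b ≡ᵇ k) + fixedBeforeLast s) (lastFixed s) (𝟙 (k <ᵇ b) + excedances s)

statFrom-∷ : ∀ k b w → w ≢ [] → statFrom k (b ∷ w) ≡ consStat k b (statFrom (suc k) w)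
statFrom-∷ k b []      w≢[] = ⊥-elim (w≢[] refl)
statFrom-∷ k b (_ ∷ _) _    = refl

withMaxBeforeLast : Stat → Stat
withMaxBeforeLast s = mkStat (fixedBeforeLast s) false (suc (excedances s))

withMaxLast : Stat → Stat
withMaxLast s = mkStat (fpOf s) true (excedances s)

children : Stat → List Stat
children s = withMaxBeforeLast s ∷ withMaxLast s ∷ []

consStat-children : ∀ k b s → map (consStat k b) (children s) ≡ children (consStat k b s)
consStat-children k b s =
  cong₂ _∷_ (cong (mkStat _ false) (+-suc (𝟙 (k <ᵇ b)) (excedances s)))
            (cong₂ _∷_ (cong (λ u → mkStat u true (𝟙 (k <ᵇ b) + excedances s))
                             (x∙yz≈y∙xz (𝟙 (b ≡ᵇ k)) (𝟙 (lastFixed s)) _))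
                       refl)

lastTwo-nonempty : ∀ m π → All (_≢ []) (lastTwo m π)
lastTwo-nonempty m []           = (λ ()) ∷ []
lastTwo-nonempty m (b ∷ [])     = (λ ()) ∷ (λ ()) ∷ []
lastTwo-nonempty m (b ∷ c ∷ cs) = map⁺ (All.universal (λ _ ()) (lastTwo m (c ∷ cs)))

-- The new maximum m = k + |π| either goes to position m - 1, an excedance that pushes the
-- last entry of π (below m) to position m where it is not fixed, or to position m, a fixed point.
statFrom-lastTwo : ∀ k b w m → k + length (b ∷ w) ≡ m → All (_< m) (b ∷ w) →
  map (statFrom k) (lastTwo m (b ∷ w)) ≡ children (statFrom k (b ∷ w))
statFrom-lastTwo k b [] m k+1≡m (b<m ∷ []) with trans (+-comm 1 k) k+1≡m
... | refl
  rewrite ≢⇒≡ᵇ≡false (>⇒≢ (n<1+n k)) | ≢⇒≡ᵇ≡false (<⇒≢ b<m) | <⇒<ᵇ≡true (n<1+n k)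
        | ≥⇒<ᵇ≡false (<⇒≤ b<m) | ≥⇒<ᵇ≡false (≤-pred b<m) | ≡ᵇ-refl k | <ᵇ-irrefl k = refl
statFrom-lastTwo k b (c ∷ w) m k+|π|≡m (b<m ∷ c∷w<m) = begin
  map (statFrom k) (map (b ∷_) L)
    ≡⟨ map-∘ L ⟨
  map (statFrom k ∘ (b ∷_)) L
    ≡⟨ map-cong-local (All.map (statFrom-∷ k b _) (lastTwo-nonempty m (c ∷ w))) ⟩
  map (consStat k b ∘ statFrom (suc k)) L
    ≡⟨ map-∘ L ⟩
  map (consStat k b) (map (statFrom (suc k)) L)
    ≡⟨ cong (map (consStat k b)) (statFrom-lastTwo (suc k) c w m k+1+|w|≡m c∷w<m) ⟩
  map (consStat k b) (children (statFrom (suc k) (c ∷ w)))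
    ≡⟨ consStat-children k b _ ⟩
  children (statFrom k (b ∷ c ∷ w)) ∎
  where
  open ≡-Reasoning
  L = lastTwo m (c ∷ w)
  k+1+|w|≡m = trans (sym (+-suc k _)) k+|π|≡m

stats : ℕ → List Stat
stats n = map (statFrom 1) (avoiders patterns n)

stats-suc : ∀ n → stats (suc (suc n)) ≡ concatMap children (stats (suc n))
stats-suc n = begin
  map (statFrom 1) (avoiders patterns (suc (suc n)))
    ≡⟨ cong (map (statFrom 1)) (avoiders-suc (suc n)) ⟩
  map (statFrom 1) (concatMap (lastTwo (suc (suc n))) (avoiders patterns (suc n)))
    ≡⟨ map-concatMap (statFrom 1) (lastTwo (suc (suc n))) (avoiders patterns (suc n)) ⟩
  concatMap (map (statFrom 1) ∘ lastTwo (suc (suc n))) (avoiders patterns (suc n))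
    ≡⟨ cong concat (map-cong-local (All.map lastTwo-stats (avoiders-distinctBounded (suc n)))) ⟩
  concatMap (children ∘ statFrom 1) (avoiders patterns (suc n))
    ≡⟨ concatMap-map children (statFrom 1) (avoiders patterns (suc n)) ⟨
  concatMap children (stats (suc n)) ∎
  where
  open ≡-Reasoning
  lastTwo-stats : ∀ {π} → DistinctBounded (suc n) π →
    map (statFrom 1) (lastTwo (suc (suc n)) π) ≡ children (statFrom 1 π)
  lastTwo-stats {b ∷ w} (length≡ , bounded , _) = statFrom-lastTwo 1 b w (suc (suc n)) (cong suc length≡) bounded

count-children : ∀ (p : Stat → Bool) ss →
  count p (concatMap children ss) ≡ count (p ∘ withMaxBeforeLast) ss + count (p ∘ withMaxLast) ss
count-children p []       = refl
count-children p (s ∷ ss) = begin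
  count p (withMaxBeforeLast s ∷ withMaxLast s ∷ concatMap children ss)
    ≡⟨ trans (count-∷ p _ _) (cong (λ t → β + t) (count-∷ p _ _)) ⟩
  β + (α + count p (concatMap children ss))
    ≡⟨ cong (λ t → β + (α + t)) (count-children p ss) ⟩
  β + (α + (count (p ∘ withMaxBeforeLast) ss + count (p ∘ withMaxLast) ss))
    ≡⟨ rearrange β α _ _ ⟩
  (β + count (p ∘ withMaxBeforeLast) ss) + (α + count (p ∘ withMaxLast) ss)
    ≡⟨ cong₂ _+_ (count-∷ (p ∘ withMaxBeforeLast) s ss) (count-∷ (p ∘ withMaxLast) s ss) ⟨
  count (p ∘ withMaxBeforeLast) (s ∷ ss) + count (p ∘ withMaxLast) (s ∷ ss) ∎
  where
  open ≡-Reasoning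
  β = 𝟙 (p (withMaxBeforeLast s))
  α = 𝟙 (p (withMaxLast s))
  rearrange : ∀ w x y z → w + (x + (y + z)) ≡ (w + y) + (x + z)
  rearrange = solve-∀

hasStats : ℕ → ℕ → Stat → Bool
hasStats i j s = (fpOf s ≡ᵇ i) ∧ (excedances s ≡ᵇ j)

lastFixedWith lastNotFixedWith : ℕ → ℕ → Stat → Bool
lastFixedWith    i j s = lastFixed s ∧ hasStats i j s
lastNotFixedWith i j s = not (lastFixed s) ∧ hasStats i j s

F-count : ∀ n i j → F patterns n i j ≡ + count (hasStats i j) (stats n)
F-count n i j = cong +_ (begin
  count (λ π → (fp π ≡ᵇ i) ∧ (exc π ≡ᵇ j)) (avoiders patterns n)
    ≡⟨ count-cong (λ π → cong (λ f → (f ≡ᵇ i) ∧ (exc π ≡ᵇ j)) (fpFrom≡fpOf 1 π)) (avoiders patterns n) ⟩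
  count (hasStats i j ∘ statFrom 1) (avoiders patterns n)
    ≡⟨ count-map (hasStats i j) (statFrom 1) (avoiders patterns n) ⟨
  count (hasStats i j) (stats n) ∎)
  where open ≡-Reasoning

-- The empty permutation is excluded by hand: its `Stat` has `lastFixed = false`.
lastNotFixed : Series
lastNotFixed zero    i j = + 0
lastNotFixed (suc n) i j = + count (lastNotFixedWith i j) (stats (suc n))

count-lastFixedWith : ∀ m i j → + count (lastFixedWith i j) (stats (suc m)) ≡ shift 1 1 0 (F patterns) (suc m) i j
count-lastFixedWith zero    zero          j       = refl
count-lastFixedWith zero    (suc zero)    zero    = refl
count-lastFixedWith zero    (suc zero)    (suc j) = refl
count-lastFixedWith zero    (suc (suc i)) j       = refl
count-lastFixedWith (suc m) i             j       = begin
  + count (lastFixedWith i j) (stats (suc (suc m)))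
    ≡⟨ cong (λ ss → + count (lastFixedWith i j) ss) (stats-suc m) ⟩
  + count (lastFixedWith i j) (concatMap children (stats (suc m)))
    ≡⟨ cong +_ (count-children (lastFixedWith i j) (stats (suc m))) ⟩
  + (count (λ _ → false) (stats (suc m)) + count (hasStats i j ∘ withMaxLast) (stats (suc m)))
    ≡⟨ cong (λ c → + (c + count (hasStats i j ∘ withMaxLast) (stats (suc m))))
            (count-none (λ _ → refl) (stats (suc m))) ⟩
  + count (hasStats i j ∘ withMaxLast) (stats (suc m))
    ≡⟨ appended i ⟩
  shift 1 1 0 (F patterns) (suc (suc m)) i j ∎
  where
  open ≡-Reasoning
  appended : ∀ i → + count (hasStats i j ∘ withMaxLast) (stats (suc m)) ≡ shift 1 1 0 (F patterns) (suc (suc m)) i j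
  appended zero    = cong +_ (count-none (λ _ → refl) (stats (suc m)))
  appended (suc i) = sym (F-count (suc m) i j)

count-lastNotFixedWith-suc : ∀ m i j →
  count (lastNotFixedWith i (suc j)) (stats (suc (suc m)))
  ≡ count (lastFixedWith (suc i) j) (stats (suc m)) + count (lastNotFixedWith i j) (stats (suc m))
count-lastNotFixedWith-suc m i j = begin
  count (lastNotFixedWith i (suc j)) (stats (suc (suc m)))
    ≡⟨ cong (count (lastNotFixedWith i (suc j))) (stats-suc m) ⟩
  count (lastNotFixedWith i (suc j)) (concatMap children (stats (suc m)))
    ≡⟨ count-children (lastNotFixedWith i (suc j)) (stats (suc m)) ⟩
  count fixedBeforeLastWith (stats (suc m)) + count (λ _ → false) (stats (suc m))
    ≡⟨ cong (λ c → count fixedBeforeLastWith (stats (suc m)) + c) (count-none (λ _ → refl) (stats (suc m))) ⟩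
  count fixedBeforeLastWith (stats (suc m)) + 0
    ≡⟨ +-identityʳ _ ⟩
  count fixedBeforeLastWith (stats (suc m))
    ≡⟨ count-split lastFixed fixedBeforeLastWith (stats (suc m)) ⟩
  count (λ s → lastFixed s ∧ fixedBeforeLastWith s) (stats (suc m))
    + count (λ s → not (lastFixed s) ∧ fixedBeforeLastWith s) (stats (suc m))
    ≡⟨ cong₂ _+_ (count-cong lastFixed-case (stats (suc m))) (count-cong lastNotFixed-case (stats (suc m))) ⟩
  count (lastFixedWith (suc i) j) (stats (suc m)) + count (lastNotFixedWith i j) (stats (suc m)) ∎
  where
  open ≡-Reasoning
  fixedBeforeLastWith : Stat → Bool
  fixedBeforeLastWith s = (fixedBeforeLast s ≡ᵇ i) ∧ (excedances s ≡ᵇ j)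
  lastFixed-case : ∀ s → (lastFixed s ∧ fixedBeforeLastWith s) ≡ lastFixedWith (suc i) j s
  lastFixed-case (mkStat _ true  _) = refl
  lastFixed-case (mkStat _ false _) = refl
  lastNotFixed-case : ∀ s → (not (lastFixed s) ∧ fixedBeforeLastWith s) ≡ lastNotFixedWith i j s
  lastNotFixed-case (mkStat _ true  _) = refl
  lastNotFixed-case (mkStat _ false _) = refl

F-decomposition : F patterns ≐ monomial 0 0 0 ⊕ shift 1 1 0 (F patterns) ⊕ lastNotFixed
F-decomposition zero    zero    zero    = refl
F-decomposition zero    zero    (suc j) = refl
F-decomposition zero    (suc i) j       = refl
F-decomposition (suc m) i       j       = begin
  F patterns (suc m) i j
    ≡⟨ F-count (suc m) i j ⟩
  + count (hasStats i j) (stats (suc m))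
    ≡⟨ cong +_ (count-split lastFixed (hasStats i j) (stats (suc m))) ⟩
  + (count (lastFixedWith i j) (stats (suc m)) + count (lastNotFixedWith i j) (stats (suc m)))
    ≡⟨ pos-+ (count (lastFixedWith i j) (stats (suc m))) _ ⟩
  + count (lastFixedWith i j) (stats (suc m)) +ℤ lastNotFixed (suc m) i j
    ≡⟨ cong (_+ℤ lastNotFixed (suc m) i j) (count-lastFixedWith m i j) ⟩
  shift 1 1 0 (F patterns) (suc m) i j +ℤ lastNotFixed (suc m) i j
    ≡⟨ cong (_+ℤ lastNotFixed (suc m) i j) (+ℤ-identityˡ (shift 1 1 0 (F patterns) (suc m) i j)) ⟨
  (monomial 0 0 0 ⊕ shift 1 1 0 (F patterns) ⊕ lastNotFixed) (suc m) i j ∎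
  where open ≡-Reasoning

lastNotFixed-recurrence : lastNotFixed ≐ shift 1 0 1 lastNotFixed ⊕ shift 2 0 1 (F patterns)
lastNotFixed-recurrence zero          i j       = refl
lastNotFixed-recurrence (suc zero)    i zero    = refl
lastNotFixed-recurrence (suc zero)    i (suc j) = refl
lastNotFixed-recurrence (suc (suc m)) i zero    = cong +_ (begin
  count (lastNotFixedWith i 0) (stats (suc (suc m)))
    ≡⟨ cong (count (lastNotFixedWith i 0)) (stats-suc m) ⟩
  count (lastNotFixedWith i 0) (concatMap children (stats (suc m)))
    ≡⟨ count-children (lastNotFixedWith i 0) (stats (suc m)) ⟩
  count (λ s → (fixedBeforeLast s ≡ᵇ i) ∧ false) (stats (suc m)) + count (λ _ → false) (stats (suc m))
    ≡⟨ cong₂ _+_ (count-none (λ _ → ∧-zeroʳ _) (stats (suc m))) (count-none (λ _ → refl) (stats (suc m))) ⟩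
  0 ∎)
  where open ≡-Reasoning
lastNotFixed-recurrence (suc (suc m)) i (suc j) = begin
  + count (lastNotFixedWith i (suc j)) (stats (suc (suc m)))
    ≡⟨ cong +_ (count-lastNotFixedWith-suc m i j) ⟩
  + (count (lastFixedWith (suc i) j) (stats (suc m)) + count (lastNotFixedWith i j) (stats (suc m)))
    ≡⟨ pos-+ (count (lastFixedWith (suc i) j) (stats (suc m))) _ ⟩
  + count (lastFixedWith (suc i) j) (stats (suc m)) +ℤ lastNotFixed (suc m) i j
    ≡⟨ cong (_+ℤ lastNotFixed (suc m) i j) (count-lastFixedWith m (suc i) j) ⟩
  F patterns m i j +ℤ lastNotFixed (suc m) i j
    ≡⟨ +ℤ-comm (F patterns m i j) (lastNotFixed (suc m) i j) ⟩
  lastNotFixed (suc m) i j +ℤ F patterns m i j ∎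
  where open ≡-Reasoning

proposition4p3 : (n i j : ℕ) →
    (F ((3 ∷ 1 ∷ 2 ∷ []) ∷ (3 ∷ 2 ∷ 1 ∷ []) ∷ []) ⊛ denom) n i j ≡ numer n i j
proposition4p3 = ⊛-denom≐numer (F patterns) lastNotFixed F-decomposition lastNotFixed-recurrence
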